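{- Let $1\le s\le t\le n$ be integers. Let $G$ be a bipartite graph with vertex classes $U,U'$ of size $n$ that is $K_{s,t}$-saturated. If the minimum degree $\delta$ of $G$ satisfies $\delta<t-1$, then $G$ has at least $n(s+t-2)-(s+t-2)^2$ edges.
   Context: $G$ is $K_{s,t}$-saturated if every missing edge $uu'$ with $u\in U$ and $u'\in U'$, when added to $G$, creates a new copy of $K_{s,t}$ (one containing $uu'$). This copy may have $s$ vertices in $U$ and $t$ in $U'$, or $t$ vertices in $U$ and $s$ in $U'$. -}

module Defs where

open import Data.Nat using (ℕ; _⊓_)
open import Data.Bool using (Bool; true; false; _∨_; _∧_)
open import Data.Fin using (Fin; _≟_)
open import Data.Fin.Subset using (Subset; _∈_; ∣_∣)
open import Data.Vec using (tabulate)
open import Data.List using (List; map; foldr; _++_; allFin)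
open import Data.Nat.ListAction using (sum)
open import Data.Product using (Σ-syntax; _×_)
open import Data.Sum using (_⊎_)
open import Relation.Nullary.Decidable using (⌊_⌋)
open import Relation.Binary.PropositionalEquality using (_≡_)

-- A bipartite graph with vertex classes U = Fin n and U' = Fin n:
-- G u u' = true  iff  uu' is an edge (u ∈ U, u' ∈ U').
BipGraph : ℕ → Set
BipGraph n = Fin n → Fin n → Bool

degU : ∀ {n} → BipGraph n → Fin n → ℕ
degU G u = ∣ tabulate (λ v → G u v) ∣

degU' : ∀ {n} → BipGraph n → Fin n → ℕ
degU' G v = ∣ tabulate (λ u → G u v) ∣

edgeCount : ∀ {n} → BipGraph n → ℕ
edgeCount {n} G = sum (map (degU G) (allFin n))

-- Minimum degree over all 2n vertices (all degrees are ≤ n, so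
-- starting the fold at n gives the true minimum when n ≥ 1).
minDegree : ∀ {n} → BipGraph n → ℕ
minDegree {n} G = foldr _⊓_ n (map (degU G) (allFin n) ++ map (degU' G) (allFin n))

addEdge : ∀ {n} → BipGraph n → Fin n → Fin n → BipGraph n
addEdge G u u' x y = G x y ∨ (⌊ x ≟ u ⌋ ∧ ⌊ y ≟ u' ⌋)

KstCopyThrough : ∀ {n} → ℕ → ℕ → BipGraph n → Fin n → Fin n → Set
KstCopyThrough {n} s t H u u' =
  Σ[ S ∈ Subset n ] Σ[ T ∈ Subset n ]
    (u ∈ S) × (u' ∈ T) ×
    ((∣ S ∣ ≡ s × ∣ T ∣ ≡ t) ⊎ (∣ S ∣ ≡ t × ∣ T ∣ ≡ s)) ×
    (∀ x y → x ∈ S → y ∈ T → H x y ≡ true)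

KstSaturated : ∀ {n} → ℕ → ℕ → BipGraph n → Set
KstSaturated s t G =
  ∀ u u' → G u u' ≡ false → KstCopyThrough s t (addEdge G u u') u u'

module Submission where

-- Let G be K_{s,t}-saturated with a vertex v of degree δ < t - 1; by
-- symmetry (transposing G) we may take v ∈ U. Put A = N(v) ⊆ U'.
--
--  * Every vertex x ∈ U has degree ≥ s - 1: adding a missing edge xy
--    creates a copy S × T with x ∈ S, y ∈ T, and x sees T - {y}.
--  * Let Y be the set of x ∈ U with ≥ s - 1 neighbours in A. For b ∉ A,
--    a copy through vb cannot have |T| = t (v would have degree ≥ t - 1),
--    so |S| = t, |T| = s; each x ∈ S - {v} sees b and T - {b} ⊆ A, hence
--    b has ≥ t - 1 neighbours in Y.
--  * Thus deg x ≥ (s - 1) + [x ∈ Y]·|N(x) - A| and, double counting the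
--    edges between Y and U' - A, e(G) ≥ n(s - 1) + (n - δ)(t - 1), which
--    is at least n(s + t - 2) - (s + t - 2)² because δ ≤ t - 1.

open import Defs
open import Data.Nat using (ℕ; zero; suc; _+_; _*_; _∸_; _^_; _≤_; _<_; z≤n; s≤s; _≤ᵇ_)
open import Data.Nat.Properties hiding (_≟_)
open import Data.Bool using (Bool; true; false; _∧_; _∨_; not) renaming (_≟_ to _≟ᵇ_)
open import Data.Bool.Properties using (∧-comm; T-≡; ¬-not)
open import Data.Fin using (Fin; _≟_)
open import Data.Fin.Properties using (any?)
open import Data.Fin.Subset using (Subset; _∈_; ∣_∣)
open import Data.Vec using (tabulate; lookup)
open import Data.Vec.Properties using (tabulate∘lookup; lookup⇒[]=)
open import Data.List using (map; allFin)
import Data.List as List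
open import Data.List.Properties using (map-tabulate; foldr-preservesᵇ)
open import Data.List.Relation.Unary.All.Properties using (++⁺; map⁺; tabulate⁺)
open import Data.Nat.ListAction using (sum)
open import Data.Product using (∃; _×_; _,_)
open import Data.Sum using (_⊎_; inj₁; inj₂; map₂)
open import Data.Empty using (⊥-elim)
open import Function using (_∘_; Equivalence)
open import Relation.Nullary using (¬_; yes; no; does)
open import Relation.Nullary.Decidable using (⌊_⌋; dec-true)
open import Relation.Binary.PropositionalEquality
open import Algebra.Properties.Semiring.Sum +-*-semiring
  using (sum-syntax; ∑-distrib-+; ∑-comm; sum-cong-≗; *-distribʳ-sum)
  renaming (sum to ∑)

𝟙 : Bool → ℕ
𝟙 true  = 1
𝟙 false = 0

count : ∀ {n} → (Fin n → Bool) → ℕ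
count {n} p = ∑[ i < n ] 𝟙 (p i)

∑-mono-≤ : ∀ {n} {f g : Fin n → ℕ} → (∀ i → f i ≤ g i) → ∑ f ≤ ∑ g
∑-mono-≤ {zero}  f≤g = z≤n
∑-mono-≤ {suc n} f≤g = +-mono-≤ (f≤g Fin.zero) (∑-mono-≤ (f≤g ∘ Fin.suc))

∑-const : ∀ n c → ∑[ i < n ] c ≡ n * c
∑-const zero    c = refl
∑-const (suc n) c = cong (c +_) (∑-const n c)

count-all : ∀ n → count {n} (λ _ → true) ≡ n
count-all n = trans (∑-const n 1) (*-identityʳ n)

count-none : ∀ n → count {n} (λ _ → false) ≡ 0
count-none n = trans (∑-const n 0) (*-zeroʳ n)

count-complement : ∀ {n} (p : Fin n → Bool) → count p + count (not ∘ p) ≡ n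
count-complement {n} p = begin
  count p + count (not ∘ p)           ≡⟨ ∑-distrib-+ (𝟙 ∘ p) (𝟙 ∘ not ∘ p) ⟨
  ∑[ i < n ] (𝟙 (p i) + 𝟙 (not (p i))) ≡⟨ sum-cong-≗ (λ i → 𝟙-complement (p i)) ⟩
  count {n} (λ _ → true)               ≡⟨ count-all n ⟩
  n                                    ∎
  where
  open ≡-Reasoning
  𝟙-complement : ∀ a → 𝟙 a + 𝟙 (not a) ≡ 1
  𝟙-complement true  = refl
  𝟙-complement false = refl

count-split : ∀ {n} (q p : Fin n → Bool) →
  count p ≡ count (λ i → q i ∧ p i) + count (λ i → not (q i) ∧ p i)
count-split q p =
  trans (sum-cong-≗ (λ i → 𝟙-split (q i) (p i)))
        (∑-distrib-+ (λ i → 𝟙 (q i ∧ p i)) (λ i → 𝟙 (not (q i) ∧ p i)))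
  where
  𝟙-split : ∀ b a → 𝟙 a ≡ 𝟙 (b ∧ a) + 𝟙 (not b ∧ a)
  𝟙-split true  a = sym (+-identityʳ (𝟙 a))
  𝟙-split false a = refl

count-mono : ∀ {n} {p q : Fin n → Bool} → (∀ i → p i ≡ true → q i ≡ true) → count p ≤ count q
count-mono p⊆q = ∑-mono-≤ (λ i → 𝟙-mono (p⊆q i))
  where
  𝟙-mono : ∀ {a b} → (a ≡ true → b ≡ true) → 𝟙 a ≤ 𝟙 b
  𝟙-mono {false} _   = z≤n
  𝟙-mono {true}  a⇒b rewrite a⇒b refl = ≤-refl

count-singleton : ∀ {n} (b : Fin n) → count (λ i → does (i ≟ b)) ≡ 1
count-singleton {suc n} Fin.zero    = cong suc (count-none n)
count-singleton {suc n} (Fin.suc b) = count-singleton b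

count-cover : ∀ {n} {p q : Fin n → Bool} (b : Fin n) →
  (∀ i → p i ≡ true → q i ≡ true ⊎ i ≡ b) → count p ≤ suc (count q)
count-cover {n} {p} {q} b cover = begin
  count p                                  ≤⟨ ∑-mono-≤ (λ i → 𝟙-∨ (map₂ (dec-true (i ≟ b)) ∘ cover i)) ⟩
  ∑[ i < n ] (𝟙 (q i) + 𝟙 (does (i ≟ b))) ≡⟨ ∑-distrib-+ (𝟙 ∘ q) _ ⟩
  count q + count (λ i → does (i ≟ b))     ≡⟨ cong (count q +_) (count-singleton b) ⟩
  count q + 1                              ≡⟨ +-comm (count q) 1 ⟩
  suc (count q)                            ∎
  where
  open ≤-Reasoning
  𝟙-∨ : ∀ {a b c} → (a ≡ true → b ≡ true ⊎ c ≡ true) → 𝟙 a ≤ 𝟙 b + 𝟙 c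
  𝟙-∨ {false}                 _ = z≤n
  𝟙-∨ {true} {true}           _ = s≤s z≤n
  𝟙-∨ {true} {false} {true}   _ = s≤s z≤n
  𝟙-∨ {true} {false} {false} a⇒ with a⇒ refl
  ... | inj₁ ()
  ... | inj₂ ()

∣tabulate∣≡count : ∀ {n} (p : Fin n → Bool) → ∣ tabulate p ∣ ≡ count p
∣tabulate∣≡count {zero}  p = refl
∣tabulate∣≡count {suc n} p with p Fin.zero
... | true  = cong suc (∣tabulate∣≡count (p ∘ Fin.suc))
... | false = ∣tabulate∣≡count (p ∘ Fin.suc)

subset-cover : ∀ {n} (S : Subset n) {q : Fin n → Bool} (b : Fin n) →
  (∀ i → i ∈ S → q i ≡ true ⊎ i ≡ b) → ∣ S ∣ ≤ suc (count q)
subset-cover S b cover = begin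
  ∣ S ∣                   ≡⟨ cong ∣_∣ (tabulate∘lookup S) ⟨
  ∣ tabulate (lookup S) ∣ ≡⟨ ∣tabulate∣≡count (lookup S) ⟩
  count (lookup S)        ≤⟨ count-cover b (λ i i∈S → cover i (lookup⇒[]= i S i∈S)) ⟩
  _                       ∎
  where open ≤-Reasoning

edgeCount≡∑count : ∀ {n} (G : BipGraph n) → edgeCount G ≡ ∑[ x < n ] count (G x)
edgeCount≡∑count {n} G = begin
  sum (map (degU G) (allFin n))         ≡⟨ cong sum (map-tabulate (λ x → x) (degU G)) ⟩
  sum (List.tabulate (degU G))          ≡⟨ sum-tabulate (degU G) ⟩
  ∑[ x < n ] degU G x                   ≡⟨ sum-cong-≗ (λ x → ∣tabulate∣≡count (G x)) ⟩
  ∑[ x < n ] count (G x)                ∎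
  where
  open ≡-Reasoning
  sum-tabulate : ∀ {m} (f : Fin m → ℕ) → sum (List.tabulate f) ≡ ∑ f
  sum-tabulate {zero}  f = refl
  sum-tabulate {suc m} f = cong (f Fin.zero +_) (sum-tabulate (f ∘ Fin.suc))

addEdge-true : ∀ {n} (G : BipGraph n) {u u' x y} →
  addEdge G u u' x y ≡ true → G x y ≡ true ⊎ (x ≡ u × y ≡ u')
addEdge-true G {u} {u'} {x} {y} e with G x y | x ≟ u | y ≟ u'
addEdge-true G e  | true  | _       | _        = inj₁ refl
addEdge-true G e  | false | yes x≡u | yes y≡u' = inj₂ (x≡u , y≡u')
addEdge-true G () | false | yes _   | no _
addEdge-true G () | false | no _    | _

module CopyThrough {n} (G : BipGraph n) (u u' : Fin n) (S T : Subset n) (u∈S : u ∈ S)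
  (edges : ∀ x y → x ∈ S → y ∈ T → addEdge G u u' x y ≡ true) where

  row : ∀ {x y} → x ∈ S → y ∈ T → G x y ≡ true ⊎ (x ≡ u × y ≡ u')
  row x∈S y∈T = addEdge-true G (edges _ _ x∈S y∈T)

  row-away-from-u : ∀ {x y} → x ∈ S → ¬ x ≡ u → y ∈ T → G x y ≡ true
  row-away-from-u x∈S x≢u y∈T with row x∈S y∈T
  ... | inj₁ e        = e
  ... | inj₂ (x≡u , _) = ⊥-elim (x≢u x≡u)

  row-cover : ∀ {x} → x ∈ S → ∣ T ∣ ≤ suc (count (G x))
  row-cover x∈S = subset-cover T u' (λ y y∈T → map₂ (λ (_ , y≡u') → y≡u') (row x∈S y∈T))

  common-cover : ∀ {x} → x ∈ S → ¬ x ≡ u → ∣ T ∣ ≤ suc (count (λ y → G u y ∧ G x y))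
  common-cover {x} x∈S x≢u = subset-cover T u' cover
    where
    cover : ∀ y → y ∈ T → (G u y ∧ G x y) ≡ true ⊎ y ≡ u'
    cover y y∈T with row u∈S y∈T
    ... | inj₂ (_ , y≡u') = inj₂ y≡u'
    ... | inj₁ e rewrite e | row-away-from-u x∈S x≢u y∈T = inj₁ refl

saturated-degree : ∀ {n s t} (G : BipGraph n) → s ≤ t → s ≤ n → KstSaturated s t G →
  ∀ x → s ∸ 1 ≤ count (G x)
saturated-degree {n} {s} {t} G s≤t s≤n sat x with any? (λ y → G x y ≟ᵇ false)
... | no no-missing = begin
  s ∸ 1                   ≤⟨ m∸n≤m s 1 ⟩
  s                       ≤⟨ s≤n ⟩
  n                       ≡⟨ count-all n ⟨
  count {n} (λ _ → true)  ≤⟨ count-mono (λ y _ → ¬-not (λ missing → no-missing (y , missing))) ⟩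
  count (G x)             ∎
  where open ≤-Reasoning
... | yes (y , missing) with sat x y missing
... | S , T , x∈S , y∈T , sizes , edges = ∸-monoˡ-≤ 1 (≤-trans (s≤∣T∣ sizes) (row-cover x∈S))
  where
  open CopyThrough G x y S T x∈S edges
  s≤∣T∣ : (∣ S ∣ ≡ s × ∣ T ∣ ≡ t) ⊎ (∣ S ∣ ≡ t × ∣ T ∣ ≡ s) → s ≤ ∣ T ∣
  s≤∣T∣ (inj₁ (_ , ∣T∣≡t)) = subst (s ≤_) (sym ∣T∣≡t) s≤t
  s≤∣T∣ (inj₂ (_ , ∣T∣≡s)) = ≤-reflexive (sym ∣T∣≡s)

module LowDegreeVertex {n} (s t : ℕ) (s≤t : s ≤ t) (s≤n : s ≤ n) (G : BipGraph n)
  (sat : KstSaturated s t G) (v : Fin n) (low : count (G v) < t ∸ 1) where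

  A : Fin n → Bool
  A = G v

  degA : Fin n → ℕ
  degA x = count (λ y → A y ∧ G x y)

  Y : Fin n → Bool
  Y x = s ∸ 1 ≤ᵇ degA x

  Y-sound : ∀ {x} → Y x ≡ true → s ∸ 1 ≤ degA x
  Y-sound {x} e = ≤ᵇ⇒≤ (s ∸ 1) (degA x) (Equivalence.from T-≡ e)

  Y-complete : ∀ {x} → s ∸ 1 ≤ degA x → Y x ≡ true
  Y-complete le = Equivalence.to T-≡ (≤⇒≤ᵇ le)

  -- For b ∉ A, a copy through vb has its t-side in U, and all its other
  -- vertices lie in Y and are adjacent to b.
  Y-neighbours : ∀ b → G v b ≡ false → t ∸ 1 ≤ count (λ x → Y x ∧ G x b)
  Y-neighbours b missing with sat v b missing
  ... | S , T , v∈S , b∈T , inj₁ (_ , ∣T∣≡t) , edges =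
    ⊥-elim (<⇒≱ low (∸-monoˡ-≤ 1 (subst (_≤ _) ∣T∣≡t (row-cover v∈S))))
    where open CopyThrough G v b S T v∈S edges
  ... | S , T , v∈S , b∈T , inj₂ (∣S∣≡t , ∣T∣≡s) , edges =
    ∸-monoˡ-≤ 1 (subst (_≤ _) ∣S∣≡t (subset-cover S v cover))
    where
    open CopyThrough G v b S T v∈S edges
    cover : ∀ x → x ∈ S → (Y x ∧ G x b) ≡ true ⊎ x ≡ v
    cover x x∈S with x ≟ v
    ... | yes x≡v = inj₂ x≡v
    ... | no x≢v  = inj₁ (cong₂ _∧_ x∈Y (row-away-from-u x∈S x≢v b∈T))
      where
      x∈Y : Y x ≡ true
      x∈Y = Y-complete (∸-monoˡ-≤ 1 (subst (_≤ _) ∣T∣≡s (common-cover x∈S x≢v)))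

  outY : Fin n → Fin n → Bool
  outY x y = Y x ∧ (not (A y) ∧ G x y)

  degree-bound : ∀ x → s ∸ 1 + count (outY x) ≤ count (G x)
  degree-bound x = bound (Y x) Y-sound
    where
    bound : ∀ c → (c ≡ true → s ∸ 1 ≤ degA x) →
      s ∸ 1 + count (λ y → c ∧ (not (A y) ∧ G x y)) ≤ count (G x)
    bound true  c⇒Y = begin
      s ∸ 1 + count (λ y → not (A y) ∧ G x y)   ≤⟨ +-monoˡ-≤ _ (c⇒Y refl) ⟩
      degA x + count (λ y → not (A y) ∧ G x y)  ≡⟨ count-split A (G x) ⟨
      count (G x)                               ∎
      where open ≤-Reasoning
    bound false _ = begin
      s ∸ 1 + count {n} (λ _ → false)  ≡⟨ cong (s ∸ 1 +_) (count-none n) ⟩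
      s ∸ 1 + 0                        ≡⟨ +-identityʳ (s ∸ 1) ⟩
      s ∸ 1                            ≤⟨ saturated-degree G s≤t s≤n sat x ⟩
      count (G x)                      ∎
      where open ≤-Reasoning

  -- Double counting the edges from Y to U' - A: each b ∉ A has ≥ t - 1 of them.
  outside-edges : count (not ∘ A) * (t ∸ 1) ≤ ∑[ x < n ] count (outY x)
  outside-edges = begin
    count (not ∘ A) * (t ∸ 1)               ≡⟨ *-distribʳ-sum (t ∸ 1) (𝟙 ∘ not ∘ A) ⟩
    ∑[ y < n ] (𝟙 (not (A y)) * (t ∸ 1))    ≤⟨ ∑-mono-≤ column-bound ⟩
    ∑[ y < n ] ∑[ x < n ] 𝟙 (outY x y)      ≡⟨ ∑-comm (λ x y → 𝟙 (outY x y)) ⟨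
    ∑[ x < n ] count (outY x)               ∎
    where
    open ≤-Reasoning
    column-bound : ∀ y → 𝟙 (not (A y)) * (t ∸ 1) ≤ count (λ x → outY x y)
    column-bound y with A y in y∉A
    ... | true  = z≤n
    ... | false = ≤-trans (≤-reflexive (+-identityʳ (t ∸ 1))) (Y-neighbours y y∉A)

  edge-bound : n * (s ∸ 1) + count (not ∘ A) * (t ∸ 1) ≤ ∑[ x < n ] count (G x)
  edge-bound = begin
    n * (s ∸ 1) + count (not ∘ A) * (t ∸ 1)             ≤⟨ +-monoʳ-≤ (n * (s ∸ 1)) outside-edges ⟩
    n * (s ∸ 1) + ∑[ x < n ] count (outY x)             ≡⟨ cong (_+ ∑[ x < n ] count (outY x)) (∑-const n (s ∸ 1)) ⟨
    ∑[ x < n ] (s ∸ 1) + ∑[ x < n ] count (outY x)      ≡⟨ ∑-distrib-+ (λ _ → s ∸ 1) (count ∘ outY) ⟨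
    ∑[ x < n ] (s ∸ 1 + count (outY x))                 ≤⟨ ∑-mono-≤ degree-bound ⟩
    ∑[ x < n ] count (G x)                              ∎
    where open ≤-Reasoning

-- The final estimate: n(a + b) ≤ e + (a + b)² whenever n·a + c·b ≤ e,
-- n = δ + c and δ ≤ b (here a = s - 1, b = t - 1, δ = deg v, c = n - δ).
edge-arithmetic : ∀ {a b c δ e n} → n * a + c * b ≤ e → δ + c ≡ n → δ ≤ b →
  n * (a + b) ≤ e + (a + b) ^ 2
edge-arithmetic {a} {b} {c} {δ} {e} {n} bound n≡δ+c δ≤b = begin
  n * (a + b)                  ≡⟨ *-distribˡ-+ n a b ⟩
  n * a + n * b                ≡⟨ cong (λ m → n * a + m * b) n≡δ+c ⟨
  n * a + (δ + c) * b          ≡⟨ cong (n * a +_) (*-distribʳ-+ b δ c) ⟩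
  n * a + (δ * b + c * b)      ≡⟨ cong (n * a +_) (+-comm (δ * b) (c * b)) ⟩
  n * a + (c * b + δ * b)      ≡⟨ +-assoc (n * a) (c * b) (δ * b) ⟨
  n * a + c * b + δ * b        ≤⟨ +-mono-≤ bound (*-mono-≤ (≤-trans δ≤b (m≤n+m b a)) (m≤n+m b a)) ⟩
  e + (a + b) * (a + b)        ≡⟨ cong (λ m → e + (a + b) * m) (*-identityʳ (a + b)) ⟨
  e + (a + b) ^ 2              ∎
  where open ≤-Reasoning

s+t∸2≡s∸1+t∸1 : ∀ {s t} → 1 ≤ s → 1 ≤ t → s + t ∸ 2 ≡ s ∸ 1 + (t ∸ 1)
s+t∸2≡s∸1+t∸1 {suc a} {suc b} _ _ rewrite +-suc a b = refl

low-degree-bound : ∀ {s t n} → 1 ≤ s → s ≤ t → t ≤ n →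
  (G : BipGraph n) → KstSaturated s t G → (v : Fin n) → degU G v < t ∸ 1 →
  n * (s + t ∸ 2) ≤ edgeCount G + (s + t ∸ 2) ^ 2
low-degree-bound {s} {t} {n} 1≤s s≤t t≤n G sat v low
  rewrite s+t∸2≡s∸1+t∸1 1≤s (≤-trans 1≤s s≤t) | edgeCount≡∑count G =
  edge-arithmetic edge-bound (count-complement (G v)) (<⇒≤ low′)
  where
  low′ : count (G v) < t ∸ 1
  low′ = subst (_< t ∸ 1) (∣tabulate∣≡count (G v)) low
  open LowDegreeVertex s t s≤t (≤-trans s≤t t≤n) G sat v low′

transpose : ∀ {n} → BipGraph n → BipGraph n
transpose G x y = G y x

-- Saturation is symmetric in U and U': a copy through u'u in G is, read
-- backwards, a copy through uu' in the transpose.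
transpose-saturated : ∀ {n s t} (G : BipGraph n) → KstSaturated s t G → KstSaturated s t (transpose G)
transpose-saturated G sat u u' missing with sat u' u missing
... | S , T , u'∈S , u∈T , sizes , edges =
  T , S , u∈T , u'∈S , swap-sizes sizes , λ x y x∈T y∈S → transpose-edge x y (edges y x y∈S x∈T)
  where
  swap-sizes : ∀ {A B C D : Set} → (A × B) ⊎ (C × D) → (D × C) ⊎ (B × A)
  swap-sizes (inj₁ (a , b)) = inj₂ (b , a)
  swap-sizes (inj₂ (c , d)) = inj₁ (d , c)
  transpose-edge : ∀ x y → addEdge G u' u y x ≡ true → addEdge (transpose G) u u' x y ≡ true
  transpose-edge x y = subst (λ z → G y x ∨ z ≡ true) (∧-comm ⌊ y ≟ u' ⌋ ⌊ x ≟ u ⌋)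

edgeCount-transpose : ∀ {n} (G : BipGraph n) → edgeCount (transpose G) ≡ edgeCount G
edgeCount-transpose {n} G = begin
  edgeCount (transpose G)                 ≡⟨ edgeCount≡∑count (transpose G) ⟩
  ∑[ y < n ] ∑[ x < n ] 𝟙 (G x y)         ≡⟨ ∑-comm (λ y x → 𝟙 (G x y)) ⟩
  ∑[ x < n ] count (G x)                  ≡⟨ edgeCount≡∑count G ⟨
  edgeCount G                             ∎
  where open ≡-Reasoning

low-degree-vertex : ∀ {n m} (G : BipGraph n) → m ≤ n → minDegree G < m →
  (∃ λ u → degU G u < m) ⊎ (∃ λ u' → degU' G u' < m)
low-degree-vertex {n} {m} G m≤n low
  with any? (λ u → degU G u <? m) | any? (λ u' → degU' G u' <? m)
... | yes w | _     = inj₁ w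
... | no _  | yes w = inj₂ w
... | no noU | no noU' = ⊥-elim (<⇒≱ low m≤minDegree)
  where
  m≤minDegree : m ≤ minDegree G
  m≤minDegree = foldr-preservesᵇ {P = m ≤_} ⊓-glb m≤n
    (++⁺ (map⁺ (tabulate⁺ (λ u → ≮⇒≥ (λ lt → noU (u , lt)))))
         (map⁺ (tabulate⁺ (λ u' → ≮⇒≥ (λ lt → noU' (u' , lt))))))

proposition2p1 : (s t n : ℕ) → 1 ≤ s → s ≤ t → t ≤ n →
    (G : BipGraph n) → KstSaturated s t G →
    minDegree G < t ∸ 1 →
    n * (s + t ∸ 2) ≤ edgeCount G + (s + t ∸ 2) ^ 2
proposition2p1 s t n 1≤s s≤t t≤n G sat low
  with low-degree-vertex G (≤-trans (m∸n≤m t 1) t≤n) low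
... | inj₁ (u , deg<) = low-degree-bound 1≤s s≤t t≤n G sat u deg<
... | inj₂ (u' , deg<) =
  subst (λ e → n * (s + t ∸ 2) ≤ e + (s + t ∸ 2) ^ 2) (edgeCount-transpose G)
    (low-degree-bound 1≤s s≤t t≤n (transpose G) (transpose-saturated G sat) u' deg<)
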